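{- $p_{2}(1,0,0)=p_{2}(1,1,1)=1$, $p_{2}(1,0,1)=p_{2}(1,1,0)=0$, and for every $n\geq 2$, \[p_{2}(n,0,0) = M_{\mathbf{c}}(n-2)+1,\qquad p_{2}(n,1,0) = p_{2}(n,0,1) = M_{\mathbf{c}}(n-1),\qquad p_{2}(n,1,1) = \begin{cases} 0, & n\equiv 0 \pmod 2, \\ 1, & n\equiv 1 \pmod 2. \end{cases}\]
   Context: The Cantor sequence $\mathbf{c}=c_0c_1c_2\cdots\in\{0,1\}^{\mathbb N}$ is defined by $c_0=1$ and $c_{3n}=c_{3n+2}=c_n$, $c_{3n+1}=0$ for all $n\geq 0$. $\mathcal F_{\mathbf c}(n)$ is the set of factors $c_i\cdots c_{i+n-1}$ of length $n$ of $\mathbf c$. For $n\geq0$, $M_{\mathbf c}(n)=\max\{\sum_{j=i}^{i+n-1}c_j\mid i\geq0\}$ (so $M_{\mathbf c}(0)=0$). For words $u,v$, $u\sim_2 v$ means $u,v$ have the same first letter, the same last letter, and $|u|_w=|v|_w$ for every word $w$ of length $2$, where $|u|_w$ is the number of occurrences of $w$ in $u$. For letters $x,y\in\{0,1\}$ and $n\geq1$, let $\mathcal W_{n,x,y}$ be the set of $w\in\mathcal F_{\mathbf c}(n)$ whose first letter is $x$ and last letter is $y$, and $p_2(n,x,y)=\mathrm{Card}(\mathcal W_{n,x,y}/\sim_2)$. -}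

module Defs where

open import Data.Nat using (ℕ; zero; suc; _+_; _≤_; _≟_; _/_; _%_)
open import Data.List using (List; []; _∷_; head; last; length)
open import Data.Nat.ListAction using (sum)
open import Data.List.Relation.Unary.All using (All)
open import Data.List.Relation.Unary.Any using (Any)
open import Data.List.Relation.Unary.AllPairs using (AllPairs)
open import Data.Product using (Σ; _×_; ∃)
open import Data.Maybe using (just)
open import Relation.Nullary using (¬_)
open import Relation.Binary.PropositionalEquality using (_≡_)

-- Cantor sequence, computed with fuel: c 0 = 1, c (3n+1) = 0,
-- c (3n) = c (3n+2) = c n.  Fuel f ≥ n suffices since n / 3 < n for n ≥ 1.
cantorF : ℕ → ℕ → ℕ
cantorF zero    _       = 1
cantorF (suc f) zero    = 1
cantorF (suc f) (suc m) with suc m % 3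
... | 1 = 0
... | _ = cantorF f (suc m / 3)

c : ℕ → ℕ
c n = cantorF n n

factorAt : ℕ → ℕ → List ℕ
factorAt i zero    = []
factorAt i (suc n) = c i ∷ factorAt (suc i) n

IsFactor : ℕ → List ℕ → Set
IsFactor n w = ∃ λ i → factorAt i n ≡ w

IsMc : ℕ → ℕ → Set
IsMc n m = (∃ λ i → sum (factorAt i n) ≡ m) × (∀ i → sum (factorAt i n) ≤ m)

isPair : ℕ → ℕ → ℕ → ℕ → ℕ
isPair a b x y with x ≟ a | y ≟ b
... | Relation.Nullary.yes _ | Relation.Nullary.yes _ = 1
... | _ | _ = 0

occ2 : ℕ → ℕ → List ℕ → ℕ
occ2 a b []           = 0
occ2 a b (x ∷ [])     = 0
occ2 a b (x ∷ y ∷ u) = isPair a b x y + occ2 a b (y ∷ u)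

_∼₂_ : List ℕ → List ℕ → Set
u ∼₂ v = (head u ≡ head v) × (last u ≡ last v) × (∀ a b → occ2 a b u ≡ occ2 a b v)

InW : ℕ → ℕ → ℕ → List ℕ → Set
InW n x y w = IsFactor n w × (head w ≡ just x) × (last w ≡ just y)

-- p₂(n,x,y) = k, i.e. Card(W_{n,x,y}/∼₂) = k : there is a list of k
-- elements of W_{n,x,y}, pairwise ∼₂-inequivalent, meeting every ∼₂-class.
P2 : ℕ → ℕ → ℕ → ℕ → Set
P2 n x y k = Σ (List (List ℕ)) λ L →
  (length L ≡ k) × All (InW n x y) L × AllPairs (λ u v → ¬ (u ∼₂ v)) L
  × (∀ w → InW n x y w → Any (λ v → w ∼₂ v) L)

module Submission where

-- Factors of c are binary words without 11, and for such words the
-- counts of 00, 01, 10, 11 are determined by the length, the end letters and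
-- the number of 1s.  Hence inside W_{n,x,y} the relation ∼₂ is equality of the
-- number of 1s, and p₂(n,x,y) is the number of values this number takes.  These
-- values are found with the prefix counts N m = c_0 + ⋯ + c_{m-1}:
--   * N is subadditive (induction on ternary digits), so M_c(m) = N m, which
--     bounds the sums once the end letters are known;
--   * the block [0, 3P), P = 3^J, is (prefix) 0^P (prefix) with a palindromic
--     prefix, so factors with every smaller sum can be placed across it;
--   * 1s sit at even positions, and factors from a 1 to a 1 of equal length
--     have equally many 1s, which settles W_{n,1,1}.

open import Defs
open import Data.Nat
open import Data.Nat.Properties
open import Data.Nat.DivMod
open import Data.Nat.Divisibility
open import Data.Nat.Induction using (<-rec)
open import Data.Nat.ListAction using (sum)
open import Data.Nat.Tactic.RingSolver using (solve-∀)
open import Data.List using (List; []; _∷_; head; last; length)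
open import Data.List.Relation.Unary.All as All using (All; []; _∷_)
open import Data.List.Relation.Unary.Any using (Any; here; there)
open import Data.List.Relation.Unary.AllPairs using (AllPairs; []; _∷_)
open import Data.Maybe using (Maybe; just)
open import Data.Maybe.Properties using (just-injective)
open import Data.Product using (_×_; _,_; proj₁; proj₂; ∃; ∃₂)
open import Data.Sum using (_⊎_; inj₁; inj₂)
open import Data.Empty using (⊥-elim)
open import Relation.Nullary using (¬_; yes; no)
open import Relation.Binary.PropositionalEquality

data Ternary : ℕ → Set where
  digit0 : ∀ q → Ternary (q * 3)
  digit1 : ∀ q → Ternary (1 + q * 3)
  digit2 : ∀ q → Ternary (2 + q * 3)

ternary : ∀ n → Ternary n
ternary zero = digit0 0
ternary (suc n) with ternary n
... | digit0 q = digit1 q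
... | digit1 q = digit2 q
... | digit2 q = digit0 (suc q)

digit-mod : ∀ r q → r < 3 → (r + q * 3) % 3 ≡ r
digit-mod r q r<3 = trans ([m+kn]%n≡m%n r q 3) (m<n⇒m%n≡m r<3)

digit-div : ∀ r q → r < 3 → (r + q * 3) / 3 ≡ q
digit-div r q r<3 = begin
  (r + q * 3) / 3   ≡⟨ +-distrib-/-∣ʳ r (n∣m*n q) ⟩
  r / 3 + q * 3 / 3 ≡⟨ cong₂ _+_ (m<n⇒m/n≡0 r<3) (m*n/n≡m q 3) ⟩
  q                 ∎
  where open ≡-Reasoning

quotient≤ : ∀ m → suc m / 3 ≤ m
quotient≤ m = ≤-pred (m/n<m (suc m) 3 (s≤s (s≤s z≤n)))

cantorF-fuel : ∀ f g n → n ≤ f → n ≤ g → cantorF f n ≡ cantorF g n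
cantorF-fuel zero    zero    zero _ _ = refl
cantorF-fuel zero    (suc g) zero _ _ = refl
cantorF-fuel (suc f) zero    zero _ _ = refl
cantorF-fuel (suc f) (suc g) zero _ _ = refl
cantorF-fuel (suc f) (suc g) (suc m) (s≤s m≤f) (s≤s m≤g) with suc m % 3
... | 1 = refl
... | 0           = cantorF-fuel f g (suc m / 3) (≤-trans (quotient≤ m) m≤f) (≤-trans (quotient≤ m) m≤g)
... | suc (suc _) = cantorF-fuel f g (suc m / 3) (≤-trans (quotient≤ m) m≤f) (≤-trans (quotient≤ m) m≤g)

c-digit1 : ∀ q → c (1 + q * 3) ≡ 0
c-digit1 q rewrite digit-mod 1 q (s≤s (s≤s z≤n)) = refl

c-digit2 : ∀ q → c (2 + q * 3) ≡ c q
c-digit2 q rewrite digit-mod 2 q (s≤s (s≤s (s≤s z≤n))) | digit-div 2 q (s≤s (s≤s (s≤s z≤n))) =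
  cantorF-fuel (suc (q * 3)) q q (≤-trans (m≤m*n q 3) (n≤1+n _)) ≤-refl

c-digit0 : ∀ q → c (q * 3) ≡ c q
c-digit0 zero = refl
c-digit0 (suc p) rewrite digit-mod 0 (suc p) (s≤s z≤n) | digit-div 0 (suc p) (s≤s z≤n) =
  cantorF-fuel (suc (suc (p * 3))) (suc p) (suc p) (s≤s (≤-trans (m≤m*n p 3) (n≤1+n _))) ≤-refl

c-binary : ∀ n → c n ≡ 0 ⊎ c n ≡ 1
c-binary n = cantorF-binary n n
  where
  cantorF-binary : ∀ f m → cantorF f m ≡ 0 ⊎ cantorF f m ≡ 1
  cantorF-binary zero    m = inj₂ refl
  cantorF-binary (suc f) zero = inj₂ refl
  cantorF-binary (suc f) (suc m) with suc m % 3
  ... | 1 = inj₁ refl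
  ... | 0 = cantorF-binary f (suc m / 3)
  ... | suc (suc _) = cantorF-binary f (suc m / 3)

-- Every 1 of the Cantor sequence sits at an even position (its ternary digits are 0 and 2).
c-one⇒even : ∀ n → c n ≡ 1 → 2 ∣ n
c-one⇒even = <-rec (λ n → c n ≡ 1 → 2 ∣ n) even-step
  where
  even-step : ∀ n → (∀ {m} → m < n → c m ≡ 1 → 2 ∣ m) → c n ≡ 1 → 2 ∣ n
  even-step n ih cn≡1 with ternary n
  ... | digit0 zero = divides 0 refl
  ... | digit0 (suc q) = ∣m⇒∣m*n 3 (ih q+1<3q+3 (trans (sym (c-digit0 (suc q))) cn≡1))
    where
    q+1<3q+3 : suc q < suc q * 3
    q+1<3q+3 = s≤s (s≤s (≤-trans (m≤m*n q 3) (n≤1+n _)))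
  ... | digit1 q with trans (sym (c-digit1 q)) cn≡1
  ... | ()
  even-step n ih cn≡1 | digit2 q =
    ∣m∣n⇒∣m+n (divides 1 refl) (∣m⇒∣m*n 3 (ih q<3q+2 (trans (sym (c-digit2 q)) cn≡1)))
    where
    q<3q+2 : q < 2 + q * 3
    q<3q+2 = s≤s (≤-trans (m≤m*n q 3) (n≤1+n _))

2∤1 : ¬ (2 ∣ 1)
2∤1 2∣1 with ∣1⇒≡1 2∣1
... | ()

c-no-11 : ∀ p → c p ≡ 1 → c (suc p) ≡ 0
c-no-11 p cp≡1 with c-binary (suc p)
... | inj₁ csp≡0 = csp≡0
... | inj₂ csp≡1 = ⊥-elim (2∤1 (∣m+n∣m⇒∣n 2∣p+1 (c-one⇒even p cp≡1)))
  where
  2∣p+1 : 2 ∣ p + 1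
  2∣p+1 = subst (2 ∣_) (+-comm 1 p) (c-one⇒even (suc p) csp≡1)

N : ℕ → ℕ
N zero    = 0
N (suc n) = N n + c n

N-mono-suc : ∀ n → N n ≤ N (suc n)
N-mono-suc n = m≤m+n (N n) (c n)

N-after-one : ∀ p → c p ≡ 1 → N (suc p) ≡ suc (N p)
N-after-one p cp≡1 = trans (cong (N p +_) cp≡1) (+-comm (N p) 1)

N-after-one-zero : ∀ p → c p ≡ 1 → N (suc (suc p)) ≡ suc (N p)
N-after-one-zero p cp≡1 = trans (cong₂ _+_ (N-after-one p cp≡1) (c-no-11 p cp≡1)) (+-identityʳ _)

-- Ternary recurrences: the prefix of length 3q consists of two copies of the
-- prefix of length q, interleaved with zeros.
N-digit0 : ∀ q → N (q * 3) ≡ N q + N q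
N-digit1 : ∀ q → N (1 + q * 3) ≡ N q + N (suc q)
N-digit2 : ∀ q → N (2 + q * 3) ≡ N q + N (suc q)

N-digit0 zero    = refl
N-digit0 (suc q) = begin
  N (2 + q * 3) + c (2 + q * 3) ≡⟨ cong₂ _+_ (N-digit2 q) (c-digit2 q) ⟩
  N q + N (suc q) + c q         ≡⟨ rearrange (N q) (N (suc q)) (c q) ⟩
  N (suc q) + (N q + c q)       ∎
  where
  open ≡-Reasoning
  rearrange : ∀ m n x → m + n + x ≡ n + (m + x)
  rearrange = solve-∀

N-digit1 q = begin
  N (q * 3) + c (q * 3) ≡⟨ cong₂ _+_ (N-digit0 q) (c-digit0 q) ⟩
  N q + N q + c q       ≡⟨ +-assoc (N q) (N q) (c q) ⟩
  N q + N (suc q)       ∎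
  where open ≡-Reasoning

N-digit2 q = begin
  N (1 + q * 3) + c (1 + q * 3) ≡⟨ cong₂ _+_ (N-digit1 q) (c-digit1 q) ⟩
  N q + N (suc q) + 0           ≡⟨ +-identityʳ _ ⟩
  N q + N (suc q)               ∎
  where open ≡-Reasoning

window-sum : ∀ i n → N i + sum (factorAt i n) ≡ N (i + n)
window-sum i zero    = trans (+-identityʳ (N i)) (cong N (sym (+-identityʳ i)))
window-sum i (suc n) = begin
  N i + (c i + sum (factorAt (suc i) n)) ≡⟨ sym (+-assoc (N i) (c i) _) ⟩
  N (suc i) + sum (factorAt (suc i) n)   ≡⟨ window-sum (suc i) n ⟩
  N (suc i + n)                          ≡⟨ cong N (sym (+-suc i n)) ⟩
  N (i + suc n)                          ∎
  where open ≡-Reasoning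

window-last : ∀ i n → last (factorAt i (suc n)) ≡ just (c (i + n))
window-last i zero    = cong (λ k → just (c k)) (sym (+-identityʳ i))
window-last i (suc n) = trans (window-last (suc i) n) (cong (λ k → just (c k)) (sym (+-suc i n)))

window-sum-snoc : ∀ i m → sum (factorAt i (suc m)) ≡ sum (factorAt i m) + c (i + m)
window-sum-snoc i m = +-cancelˡ-≡ (N i) _ _ (begin
  N i + sum (factorAt i (suc m))       ≡⟨ window-sum i (suc m) ⟩
  N (i + suc m)                        ≡⟨ cong N (+-suc i m) ⟩
  N (i + m) + c (i + m)                ≡⟨ cong (_+ c (i + m)) (sym (window-sum i m)) ⟩
  N i + sum (factorAt i m) + c (i + m) ≡⟨ +-assoc (N i) _ _ ⟩
  N i + (sum (factorAt i m) + c (i + m)) ∎)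
  where open ≡-Reasoning

-- Subadditivity of N, strengthened at the next position so that it survives
-- the ternary recursion: this is the statement proved by induction on x + y.
Subadditive : ℕ → ℕ → Set
Subadditive x y = N (x + y) ≤ N x + N y × N (suc (x + y)) ≤ N x + N y + c x * c y

subadditive-swap : ∀ x y → Subadditive x y → Subadditive y x
subadditive-swap x y (le₀ , le₁) =
  subst₂ _≤_ (cong N (+-comm x y)) (+-comm (N x) (N y)) le₀ ,
  subst₂ _≤_ (cong (λ s → N (suc s)) (+-comm x y)) (cong₂ _+_ (+-comm (N x) (N y)) (*-comm (c x) (c y))) le₁

subadditive-zero : ∀ y → Subadditive 0 y
subadditive-zero y = ≤-refl , +-monoʳ-≤ (N y) (≤-reflexive (sym (+-identityʳ (c y))))

N-bound-cong : ∀ {s t B} → s ≡ t → N s ≤ B → N t ≤ B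
N-bound-cong refl le = le

module _ (a b : ℕ) where
  open ≤-Reasoning

  bound-01 : Subadditive a b → Subadditive a (suc b) →
             N (a + b) + N (suc (a + b)) ≤ (N a + N a) + (N b + N (suc b))
  bound-01 (le₀ , _) (le₀′ , _) = begin
    N (a + b) + N (suc (a + b))     ≤⟨ +-mono-≤ le₀ (N-bound-cong (+-suc a b) le₀′) ⟩
    (N a + N b) + (N a + N (suc b)) ≡⟨ rearrange (N a) (N b) (N (suc b)) ⟩
    (N a + N a) + (N b + N (suc b)) ∎
    where
    rearrange : ∀ p q r → (p + q) + (p + r) ≡ (p + p) + (q + r)
    rearrange = solve-∀

  bound-11 : Subadditive (suc a) b → Subadditive a (suc b) →
             N (suc (a + b)) + N (suc (a + b)) ≤ (N a + N (suc a)) + (N b + N (suc b))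
  bound-11 (le₀ , _) (le₀′ , _) = begin
    N (suc (a + b)) + N (suc (a + b)) ≤⟨ +-mono-≤ le₀ (N-bound-cong (+-suc a b) le₀′) ⟩
    (N (suc a) + N b) + (N a + N (suc b)) ≡⟨ rearrange (N a) (N (suc a)) (N b) (N (suc b)) ⟩
    (N a + N (suc a)) + (N b + N (suc b)) ∎
    where
    rearrange : ∀ p p′ q q′ → (p′ + q) + (p + q′) ≡ (p + p′) + (q + q′)
    rearrange = solve-∀

  bound-12-product-zero : Subadditive a b → Subadditive (suc a) (suc b) → c a * c b ≡ 0 →
    N (suc (a + b)) + N (suc (suc (a + b))) ≤ (N a + N (suc a)) + (N b + N (suc b))
  bound-12-product-zero (_ , le₁) (le₀′ , _) product≡0 = begin
    N (suc (a + b)) + N (suc (suc (a + b)))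
      ≤⟨ +-mono-≤ le₁ (N-bound-cong (cong suc (+-suc a b)) le₀′) ⟩
    (N a + N b + c a * c b) + (N (suc a) + N (suc b))
      ≡⟨ cong (λ z → (N a + N b + z) + (N (suc a) + N (suc b))) product≡0 ⟩
    (N a + N b + 0) + (N (suc a) + N (suc b)) ≡⟨ cong (_+ (N (suc a) + N (suc b))) (+-identityʳ (N a + N b)) ⟩
    (N a + N b) + (N (suc a) + N (suc b))     ≡⟨ interchange (N a) (N b) (N (suc a)) (N (suc b)) ⟩
    (N a + N (suc a)) + (N b + N (suc b))     ∎
    where
    interchange : ∀ p q p′ q′ → (p + q) + (p′ + q′) ≡ (p + p′) + (q + q′)
    interchange = solve-∀

  -- The only place where the letters matter: if c a = c b = 1 then a and b are
  -- even, so a + b + 1 is odd and N does not grow there.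
  bound-12 : Subadditive a b → Subadditive (suc a) (suc b) →
             N (suc (a + b)) + N (suc (suc (a + b))) ≤ (N a + N (suc a)) + (N b + N (suc b))
  bound-12 h h↗ with c-binary a | c-binary b
  ... | inj₁ ca≡0 | _         = bound-12-product-zero h h↗ (cong (_* c b) ca≡0)
  ... | inj₂ _    | inj₁ cb≡0 = bound-12-product-zero h h↗ (trans (cong (c a *_) cb≡0) (*-zeroʳ (c a)))
  ... | inj₂ ca≡1 | inj₂ cb≡1 = begin
    N (suc (a + b)) + (N (suc (a + b)) + c (suc (a + b)))
      ≡⟨ cong (λ z → N (suc (a + b)) + (N (suc (a + b)) + z)) odd-position-zero ⟩
    N (suc (a + b)) + (N (suc (a + b)) + 0) ≤⟨ +-mono-≤ bound (≤-trans (≤-reflexive (+-identityʳ _)) bound) ⟩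
    (N a + N b + 1) + (N a + N b + 1)       ≡⟨ rearrange (N a) (N b) ⟩
    (N a + (N a + 1)) + (N b + (N b + 1))
      ≡⟨ cong₂ (λ u v → (N a + (N a + u)) + (N b + (N b + v))) (sym ca≡1) (sym cb≡1) ⟩
    (N a + N (suc a)) + (N b + N (suc b))   ∎
    where
    rearrange : ∀ p q → (p + q + 1) + (p + q + 1) ≡ (p + (p + 1)) + (q + (q + 1))
    rearrange = solve-∀
    bound : N (suc (a + b)) ≤ N a + N b + 1
    bound = subst₂ (λ u v → N (suc (a + b)) ≤ N a + N b + u * v) ca≡1 cb≡1 (proj₂ h)
    odd-position-zero : c (suc (a + b)) ≡ 0
    odd-position-zero with c-binary (suc (a + b))
    ... | inj₁ c≡0 = c≡0
    ... | inj₂ c≡1 = ⊥-elim (2∤1 (∣m+n∣m⇒∣n (subst (2 ∣_) (+-comm 1 (a + b)) (c-one⇒even _ c≡1))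
                                           (∣m∣n⇒∣m+n (c-one⇒even a ca≡1) (c-one⇒even b cb≡1))))

digits-sum : ∀ r s a b → (r + a * 3) + (s + b * 3) ≡ (r + s) + (a + b) * 3
digits-sum = solve-∀

digit-case : ∀ x y t m → x + y ≡ t + m * 3 →
             N (t + m * 3) ≤ N x + N y → N (suc t + m * 3) ≤ N x + N y + c x * c y →
             Subadditive x y
digit-case x y t m eq le₀ le₁ = N-bound-cong (sym eq) le₀ , N-bound-cong (cong suc (sym eq)) le₁

swap-ih : ∀ x y → (∀ x′ y′ → x′ + y′ < x + y → Subadditive x′ y′) →
          ∀ x′ y′ → x′ + y′ < y + x → Subadditive x′ y′
swap-ih x y ih x′ y′ lt = ih x′ y′ (subst (x′ + y′ <_) (+-comm y x) lt)

≤-+product : ∀ {L R} x y → L ≤ R → L ≤ R + c x * c y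
≤-+product x y le = ≤-trans le (m≤m+n _ (c x * c y))

-- The six digit cases (the remaining three follow by symmetry).  In each, the
-- hypotheses are Subadditive at neighbours of (a, b).
module _ (a b : ℕ) where
  open ≤-Reasoning

  subadditive-00 : Subadditive a b → Subadditive (a * 3) (b * 3)
  subadditive-00 (le₀ , le₁) = digit-case (a * 3) (b * 3) 0 (a + b) (digits-sum 0 0 a b)
    (begin
      N ((a + b) * 3)               ≡⟨ N-digit0 (a + b) ⟩
      N (a + b) + N (a + b)         ≤⟨ +-mono-≤ le₀ le₀ ⟩
      (N a + N b) + (N a + N b)     ≡⟨ interchange (N a) (N b) ⟩
      (N a + N a) + (N b + N b)     ≡⟨ sym (cong₂ _+_ (N-digit0 a) (N-digit0 b)) ⟩
      N (a * 3) + N (b * 3)         ∎)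
    (begin
      N (1 + (a + b) * 3)                       ≡⟨ N-digit1 (a + b) ⟩
      N (a + b) + N (suc (a + b))               ≤⟨ +-mono-≤ le₀ le₁ ⟩
      (N a + N b) + (N a + N b + c a * c b)     ≡⟨ rearrange (N a) (N b) (c a * c b) ⟩
      (N a + N a) + (N b + N b) + c a * c b
        ≡⟨ sym (cong₂ _+_ (cong₂ _+_ (N-digit0 a) (N-digit0 b)) (cong₂ _*_ (c-digit0 a) (c-digit0 b))) ⟩
      N (a * 3) + N (b * 3) + c (a * 3) * c (b * 3) ∎)
    where
    interchange : ∀ p q → (p + q) + (p + q) ≡ (p + p) + (q + q)
    interchange = solve-∀
    rearrange : ∀ p q x → (p + q) + (p + q + x) ≡ (p + p) + (q + q) + x
    rearrange = solve-∀

  subadditive-01 : Subadditive a b → Subadditive a (suc b) → Subadditive (a * 3) (1 + b * 3)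
  subadditive-01 h h↑ = digit-case (a * 3) (1 + b * 3) 1 (a + b) (digits-sum 0 1 a b)
    (≤-trans (≤-reflexive (N-digit1 (a + b))) bound)
    (≤-+product (a * 3) (1 + b * 3) (≤-trans (≤-reflexive (N-digit2 (a + b))) bound))
    where
    bound : N (a + b) + N (suc (a + b)) ≤ N (a * 3) + N (1 + b * 3)
    bound = begin
      N (a + b) + N (suc (a + b))     ≤⟨ bound-01 a b h h↑ ⟩
      (N a + N a) + (N b + N (suc b)) ≡⟨ sym (cong₂ _+_ (N-digit0 a) (N-digit1 b)) ⟩
      N (a * 3) + N (1 + b * 3)       ∎

  subadditive-02 : Subadditive a b → Subadditive a (suc b) → Subadditive (a * 3) (2 + b * 3)
  subadditive-02 h@(_ , le₁) h↑@(le₀↑ , _) = digit-case (a * 3) (2 + b * 3) 2 (a + b) (digits-sum 0 2 a b)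
    (begin
      N (2 + (a + b) * 3)             ≡⟨ N-digit2 (a + b) ⟩
      N (a + b) + N (suc (a + b))     ≤⟨ bound-01 a b h h↑ ⟩
      (N a + N a) + (N b + N (suc b)) ≡⟨ sym (cong₂ _+_ (N-digit0 a) (N-digit2 b)) ⟩
      N (a * 3) + N (2 + b * 3)       ∎)
    (begin
      N (suc (a + b) * 3)                             ≡⟨ N-digit0 (suc (a + b)) ⟩
      N (suc (a + b)) + N (suc (a + b))
        ≤⟨ +-mono-≤ (N-bound-cong (+-suc a b) le₀↑) le₁ ⟩
      (N a + N (suc b)) + (N a + N b + c a * c b)     ≡⟨ rearrange (N a) (N b) (N (suc b)) (c a * c b) ⟩
      (N a + N a) + (N b + N (suc b)) + c a * c b
        ≡⟨ sym (cong₂ _+_ (cong₂ _+_ (N-digit0 a) (N-digit2 b)) (cong₂ _*_ (c-digit0 a) (c-digit2 b))) ⟩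
      N (a * 3) + N (2 + b * 3) + c (a * 3) * c (2 + b * 3) ∎)
    where
    rearrange : ∀ p q q′ x → (p + q′) + (p + q + x) ≡ (p + p) + (q + q′) + x
    rearrange = solve-∀

  subadditive-11 : Subadditive a b → Subadditive (suc a) b → Subadditive a (suc b) →
                   Subadditive (1 + a * 3) (1 + b * 3)
  subadditive-11 (le₀ , _) h→@(le₀→ , _) h↑ = digit-case (1 + a * 3) (1 + b * 3) 2 (a + b) (digits-sum 1 1 a b)
    (begin
      N (2 + (a + b) * 3)                   ≡⟨ N-digit2 (a + b) ⟩
      N (a + b) + N (suc (a + b))           ≤⟨ +-mono-≤ le₀ le₀→ ⟩
      (N a + N b) + (N (suc a) + N b)       ≡⟨ rearrange (N a) (N (suc a)) (N b) ⟩
      (N a + N (suc a)) + (N b + N b)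
        ≤⟨ +-monoʳ-≤ (N a + N (suc a)) (+-monoʳ-≤ (N b) (N-mono-suc b)) ⟩
      (N a + N (suc a)) + (N b + N (suc b)) ≡⟨ sym (cong₂ _+_ (N-digit1 a) (N-digit1 b)) ⟩
      N (1 + a * 3) + N (1 + b * 3)         ∎)
    (≤-+product (1 + a * 3) (1 + b * 3) (begin
      N (suc (a + b) * 3)                   ≡⟨ N-digit0 (suc (a + b)) ⟩
      N (suc (a + b)) + N (suc (a + b))     ≤⟨ bound-11 a b h→ h↑ ⟩
      (N a + N (suc a)) + (N b + N (suc b)) ≡⟨ sym (cong₂ _+_ (N-digit1 a) (N-digit1 b)) ⟩
      N (1 + a * 3) + N (1 + b * 3)         ∎))
    where
    rearrange : ∀ p p′ q → (p + q) + (p′ + q) ≡ (p + p′) + (q + q)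
    rearrange = solve-∀

  subadditive-12 : Subadditive a b → Subadditive (suc a) b → Subadditive a (suc b) →
                   Subadditive (suc a) (suc b) → Subadditive (1 + a * 3) (2 + b * 3)
  subadditive-12 h h→ h↑ h↗ = digit-case (1 + a * 3) (2 + b * 3) 3 (a + b) (digits-sum 1 2 a b)
    (begin
      N (suc (a + b) * 3)                   ≡⟨ N-digit0 (suc (a + b)) ⟩
      N (suc (a + b)) + N (suc (a + b))     ≤⟨ bound-11 a b h→ h↑ ⟩
      (N a + N (suc a)) + (N b + N (suc b)) ≡⟨ sym (cong₂ _+_ (N-digit1 a) (N-digit2 b)) ⟩
      N (1 + a * 3) + N (2 + b * 3)         ∎)
    (≤-+product (1 + a * 3) (2 + b * 3) (begin
      N (1 + suc (a + b) * 3)                   ≡⟨ N-digit1 (suc (a + b)) ⟩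
      N (suc (a + b)) + N (suc (suc (a + b)))   ≤⟨ bound-12 a b h h↗ ⟩
      (N a + N (suc a)) + (N b + N (suc b))     ≡⟨ sym (cong₂ _+_ (N-digit1 a) (N-digit2 b)) ⟩
      N (1 + a * 3) + N (2 + b * 3)             ∎))

  subadditive-22 : Subadditive a b → Subadditive (suc a) (suc b) → Subadditive (2 + a * 3) (2 + b * 3)
  subadditive-22 h h↗ = digit-case (2 + a * 3) (2 + b * 3) 4 (a + b) (digits-sum 2 2 a b)
    (≤-trans (≤-reflexive (N-digit1 (suc (a + b)))) bound)
    (≤-+product (2 + a * 3) (2 + b * 3) (≤-trans (≤-reflexive (N-digit2 (suc (a + b)))) bound))
    where
    bound : N (suc (a + b)) + N (suc (suc (a + b))) ≤ N (2 + a * 3) + N (2 + b * 3)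
    bound = begin
      N (suc (a + b)) + N (suc (suc (a + b))) ≤⟨ bound-12 a b h h↗ ⟩
      (N a + N (suc a)) + (N b + N (suc b))   ≡⟨ sym (cong₂ _+_ (N-digit2 a) (N-digit2 b)) ⟩
      N (2 + a * 3) + N (2 + b * 3)           ∎

at-neighbour : ∀ r s a b δ ε →
               (∀ x′ y′ → x′ + y′ < (r + a * 3) + (s + b * 3) → Subadditive x′ y′) →
               δ + ε < r + s + (a + b) * 2 → Subadditive (δ + a) (ε + b)
at-neighbour r s a b δ ε ih lt =
  ih (δ + a) (ε + b) (subst₂ _<_ (sym (regroupˡ δ ε a b)) (sym (regroupʳ r s a b)) (+-monoˡ-< (a + b) lt))
  where
  regroupˡ : ∀ δ ε a b → (δ + a) + (ε + b) ≡ (δ + ε) + (a + b)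
  regroupˡ = solve-∀
  regroupʳ : ∀ r s a b → (r + a * 3) + (s + b * 3) ≡ (r + s + (a + b) * 2) + (a + b)
  regroupʳ = solve-∀

subadditive-step : ∀ x y → (∀ x′ y′ → x′ + y′ < x + y → Subadditive x′ y′) → Subadditive x y
subadditive-step x y ih with ternary x | ternary y
... | digit0 zero    | _              = subadditive-zero y
... | _              | digit0 zero    = subadditive-swap 0 x (subadditive-zero x)
... | digit0 (suc a) | digit0 (suc b) =
  subadditive-00 (suc a) (suc b) (at-neighbour 0 0 (suc a) (suc b) 0 0 ih (s≤s z≤n))
... | digit0 (suc a) | digit1 b =
  subadditive-01 (suc a) b (at-neighbour 0 1 (suc a) b 0 0 ih (s≤s z≤n))
                           (at-neighbour 0 1 (suc a) b 0 1 ih (s≤s (s≤s z≤n)))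
... | digit0 (suc a) | digit2 b =
  subadditive-02 (suc a) b (at-neighbour 0 2 (suc a) b 0 0 ih (s≤s z≤n))
                           (at-neighbour 0 2 (suc a) b 0 1 ih (s≤s (s≤s z≤n)))
... | digit1 a | digit1 b =
  subadditive-11 a b (at-neighbour 1 1 a b 0 0 ih (s≤s z≤n))
                     (at-neighbour 1 1 a b 1 0 ih (s≤s (s≤s z≤n)))
                     (at-neighbour 1 1 a b 0 1 ih (s≤s (s≤s z≤n)))
... | digit1 a | digit2 b =
  subadditive-12 a b (at-neighbour 1 2 a b 0 0 ih (s≤s z≤n))
                     (at-neighbour 1 2 a b 1 0 ih (s≤s (s≤s z≤n)))
                     (at-neighbour 1 2 a b 0 1 ih (s≤s (s≤s z≤n)))
                     (at-neighbour 1 2 a b 1 1 ih (s≤s (s≤s (s≤s z≤n))))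
... | digit2 a | digit2 b =
  subadditive-22 a b (at-neighbour 2 2 a b 0 0 ih (s≤s z≤n))
                     (at-neighbour 2 2 a b 1 1 ih (s≤s (s≤s (s≤s z≤n))))
... | digit1 a | digit0 (suc b) = subadditive-swap (suc b * 3) (1 + a * 3)
  (subadditive-01 (suc b) a (at-neighbour 0 1 (suc b) a 0 0 (swap-ih x y ih) (s≤s z≤n))
                            (at-neighbour 0 1 (suc b) a 0 1 (swap-ih x y ih) (s≤s (s≤s z≤n))))
... | digit2 a | digit0 (suc b) = subadditive-swap (suc b * 3) (2 + a * 3)
  (subadditive-02 (suc b) a (at-neighbour 0 2 (suc b) a 0 0 (swap-ih x y ih) (s≤s z≤n))
                            (at-neighbour 0 2 (suc b) a 0 1 (swap-ih x y ih) (s≤s (s≤s z≤n))))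
... | digit2 a | digit1 b = subadditive-swap (1 + b * 3) (2 + a * 3)
  (subadditive-12 b a (at-neighbour 1 2 b a 0 0 (swap-ih x y ih) (s≤s z≤n))
                      (at-neighbour 1 2 b a 1 0 (swap-ih x y ih) (s≤s (s≤s z≤n)))
                      (at-neighbour 1 2 b a 0 1 (swap-ih x y ih) (s≤s (s≤s z≤n)))
                      (at-neighbour 1 2 b a 1 1 (swap-ih x y ih) (s≤s (s≤s (s≤s z≤n)))))

subadditive-below : ∀ f x y → x + y < f → Subadditive x y
subadditive-below (suc f) x y (s≤s x+y≤f) =
  subadditive-step x y (λ x′ y′ lt → subadditive-below f x′ y′ (≤-trans lt x+y≤f))

N-subadditive : ∀ x y → N (x + y) ≤ N x + N y
N-subadditive x y = proj₁ (subadditive-below (suc (x + y)) x y ≤-refl)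

-- By subadditivity no factor of length m has more 1s than the prefix: M_c(m) = N m.
window-bound : ∀ i m → sum (factorAt i m) ≤ N m
window-bound i m = +-cancelˡ-≤ (N i) _ _ (subst (_≤ N i + N m) (sym (window-sum i m)) (N-subadditive i m))

IsMc-N : ∀ m → IsMc m (N m)
IsMc-N m = (0 , window-sum 0 m) , λ i → window-bound i m

-- Self-similarity.  Writing P = 3 ^ J, the prefix of length 3P is
-- (prefix of length P) 0^P (prefix of length P), and the prefix of length P is
-- a palindrome.

quotient<P : ∀ r q P → r + q * 3 < 3 * P → q < P
quotient<P r q P lt =
  *-cancelʳ-< 3 q P (≤-trans (s≤s (m≤n+m (q * 3) r)) (subst (suc (r + q * 3) ≤_) (*-comm 3 P) lt))

shift-digit : ∀ P r q → 3 * P + (r + q * 3) ≡ r + (P + q) * 3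
shift-digit = solve-∀

shift-digit₂ : ∀ P r q → 3 * P + 3 * P + (r + q * 3) ≡ r + (P + P + q) * 3
shift-digit₂ = solve-∀

c-middle-third : ∀ J e → e < 3 ^ J → c (3 ^ J + e) ≡ 0
c-middle-third zero    zero    _        = refl
c-middle-third zero    (suc e) (s≤s ())
c-middle-third (suc J) e       e<3P with ternary e
... | digit0 q = begin
  c (3 * 3 ^ J + q * 3) ≡⟨ cong c (shift-digit (3 ^ J) 0 q) ⟩
  c ((3 ^ J + q) * 3)   ≡⟨ c-digit0 (3 ^ J + q) ⟩
  c (3 ^ J + q)         ≡⟨ c-middle-third J q (quotient<P 0 q (3 ^ J) e<3P) ⟩
  0                     ∎
  where open ≡-Reasoning
... | digit1 q = trans (cong c (shift-digit (3 ^ J) 1 q)) (c-digit1 (3 ^ J + q))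
... | digit2 q = begin
  c (3 * 3 ^ J + (2 + q * 3)) ≡⟨ cong c (shift-digit (3 ^ J) 2 q) ⟩
  c (2 + (3 ^ J + q) * 3)     ≡⟨ c-digit2 (3 ^ J + q) ⟩
  c (3 ^ J + q)               ≡⟨ c-middle-third J q (quotient<P 2 q (3 ^ J) e<3P) ⟩
  0                           ∎
  where open ≡-Reasoning

c-last-third : ∀ J e → e < 3 ^ J → c (3 ^ J + 3 ^ J + e) ≡ c e
c-last-third zero    zero    _        = refl
c-last-third zero    (suc e) (s≤s ())
c-last-third (suc J) e       e<3P with ternary e
... | digit0 q = begin
  c (3 * 3 ^ J + 3 * 3 ^ J + q * 3) ≡⟨ cong c (shift-digit₂ (3 ^ J) 0 q) ⟩
  c ((3 ^ J + 3 ^ J + q) * 3)       ≡⟨ c-digit0 (3 ^ J + 3 ^ J + q) ⟩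
  c (3 ^ J + 3 ^ J + q)             ≡⟨ c-last-third J q (quotient<P 0 q (3 ^ J) e<3P) ⟩
  c q                               ≡⟨ sym (c-digit0 q) ⟩
  c (q * 3)                         ∎
  where open ≡-Reasoning
... | digit1 q = trans (cong c (shift-digit₂ (3 ^ J) 1 q)) (trans (c-digit1 (3 ^ J + 3 ^ J + q)) (sym (c-digit1 q)))
... | digit2 q = begin
  c (3 * 3 ^ J + 3 * 3 ^ J + (2 + q * 3)) ≡⟨ cong c (shift-digit₂ (3 ^ J) 2 q) ⟩
  c (2 + (3 ^ J + 3 ^ J + q) * 3)         ≡⟨ c-digit2 (3 ^ J + 3 ^ J + q) ⟩
  c (3 ^ J + 3 ^ J + q)                   ≡⟨ c-last-third J q (quotient<P 2 q (3 ^ J) e<3P) ⟩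
  c q                                     ≡⟨ sym (c-digit2 q) ⟩
  c (2 + q * 3)                           ∎
  where open ≡-Reasoning

multiple-of-3 : ∀ k Q P → k + Q * 3 ≡ 3 * P → k % 3 ≡ 0
multiple-of-3 k Q P eq = begin
  k % 3               ≡⟨ sym ([m+kn]%n≡m%n k Q 3) ⟩
  (k + Q * 3) % 3     ≡⟨ cong (_% 3) (trans eq (*-comm 3 P)) ⟩
  (P * 3) % 3         ≡⟨ m*n%n≡0 P 3 ⟩
  0                   ∎
  where open ≡-Reasoning

reflected-quotients : ∀ q q′ P → 3 + (q + q′) * 3 ≡ 3 * P → q + suc q′ ≡ P
reflected-quotients q q′ P eq = trans (+-suc q q′) (*-cancelʳ-≡ (suc (q + q′)) P 3 (trans eq (*-comm 3 P)))

digit-pair-sum : ∀ r r′ q q′ → (r + q * 3) + suc (r′ + q′ * 3) ≡ suc (r + r′) + (q + q′) * 3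
digit-pair-sum = solve-∀

-- Reflection: the prefix of length 3 ^ J is a palindrome, since d ↦ 3 ^ J - 1 - d
-- exchanges the ternary digits 0 and 2 and fixes the digit 1.
c-reflect : ∀ J d m → d + suc m ≡ 3 ^ J → c d ≡ c m
c-reflect zero zero    zero    _  = refl
c-reflect zero (suc d) m       eq with trans (sym (+-suc d m)) (cong pred eq)
... | ()
c-reflect (suc J) d m eq with ternary d | ternary m
... | digit0 q | digit2 q′ = begin
  c (q * 3)     ≡⟨ c-digit0 q ⟩
  c q           ≡⟨ c-reflect J q q′ (reflected-quotients q q′ (3 ^ J) (trans (sym (digit-pair-sum 0 2 q q′)) eq)) ⟩
  c q′          ≡⟨ sym (c-digit2 q′) ⟩
  c (2 + q′ * 3) ∎
  where open ≡-Reasoning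
... | digit1 q | digit1 q′ = trans (c-digit1 q) (sym (c-digit1 q′))
... | digit2 q | digit0 q′ = begin
  c (2 + q * 3) ≡⟨ c-digit2 q ⟩
  c q           ≡⟨ c-reflect J q q′ (reflected-quotients q q′ (3 ^ J) (trans (sym (digit-pair-sum 2 0 q q′)) eq)) ⟩
  c q′          ≡⟨ sym (c-digit0 q′) ⟩
  c (q′ * 3)    ∎
  where open ≡-Reasoning
-- The remaining six digit pairs cannot add up to a multiple of 3.
... | digit0 q | digit0 q′
  with multiple-of-3 1 (q + q′) (3 ^ J) (trans (sym (digit-pair-sum 0 0 q q′)) eq)
...   | ()
c-reflect (suc J) d m eq | digit0 q | digit1 q′
  with multiple-of-3 2 (q + q′) (3 ^ J) (trans (sym (digit-pair-sum 0 1 q q′)) eq)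
...   | ()
c-reflect (suc J) d m eq | digit1 q | digit0 q′
  with multiple-of-3 2 (q + q′) (3 ^ J) (trans (sym (digit-pair-sum 1 0 q q′)) eq)
...   | ()
c-reflect (suc J) d m eq | digit1 q | digit2 q′
  with multiple-of-3 4 (q + q′) (3 ^ J) (trans (sym (digit-pair-sum 1 2 q q′)) eq)
...   | ()
c-reflect (suc J) d m eq | digit2 q | digit1 q′
  with multiple-of-3 4 (q + q′) (3 ^ J) (trans (sym (digit-pair-sum 2 1 q q′)) eq)
...   | ()
c-reflect (suc J) d m eq | digit2 q | digit2 q′
  with multiple-of-3 5 (q + q′) (3 ^ J) (trans (sym (digit-pair-sum 2 2 q q′)) eq)
...   | ()

N-middle-third : ∀ J e → e ≤ 3 ^ J → N (3 ^ J + e) ≡ N (3 ^ J)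
N-middle-third J zero    _   = cong N (+-identityʳ (3 ^ J))
N-middle-third J (suc e) e<P = begin
  N (3 ^ J + suc e)          ≡⟨ cong N (+-suc (3 ^ J) e) ⟩
  N (3 ^ J + e) + c (3 ^ J + e) ≡⟨ cong₂ _+_ (N-middle-third J e (<⇒≤ e<P)) (c-middle-third J e e<P) ⟩
  N (3 ^ J) + 0              ≡⟨ +-identityʳ _ ⟩
  N (3 ^ J)                  ∎
  where open ≡-Reasoning

N-last-third : ∀ J e → e ≤ 3 ^ J → N (3 ^ J + 3 ^ J + e) ≡ N (3 ^ J) + N e
N-last-third J zero    _   = begin
  N (3 ^ J + 3 ^ J + 0) ≡⟨ cong N (+-identityʳ (3 ^ J + 3 ^ J)) ⟩
  N (3 ^ J + 3 ^ J)     ≡⟨ N-middle-third J (3 ^ J) ≤-refl ⟩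
  N (3 ^ J)             ≡⟨ sym (+-identityʳ _) ⟩
  N (3 ^ J) + 0         ∎
  where open ≡-Reasoning
N-last-third J (suc e) e<P = begin
  N (3 ^ J + 3 ^ J + suc e)                       ≡⟨ cong N (+-suc (3 ^ J + 3 ^ J) e) ⟩
  N (3 ^ J + 3 ^ J + e) + c (3 ^ J + 3 ^ J + e) ≡⟨ cong₂ _+_ (N-last-third J e (<⇒≤ e<P)) (c-last-third J e e<P) ⟩
  N (3 ^ J) + N e + c e                           ≡⟨ +-assoc (N (3 ^ J)) (N e) (c e) ⟩
  N (3 ^ J) + N (suc e)                           ∎
  where open ≡-Reasoning

N-reflect : ∀ J d m → d + m ≡ 3 ^ J → N d + N m ≡ N (3 ^ J)
N-reflect J d zero    eq = trans (+-identityʳ (N d)) (cong N (trans (sym (+-identityʳ d)) eq))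
N-reflect J d (suc m) eq = begin
  N d + (N m + c m) ≡⟨ cong (λ z → N d + (N m + z)) (sym (c-reflect J d m eq)) ⟩
  N d + (N m + c d) ≡⟨ rearrange (N d) (N m) (c d) ⟩
  N (suc d) + N m   ≡⟨ N-reflect J (suc d) m (trans (sym (+-suc d m)) eq) ⟩
  N (3 ^ J)         ∎
  where
  open ≡-Reasoning
  rearrange : ∀ p q x → p + (q + x) ≡ (p + x) + q
  rearrange = solve-∀

n<3^n : ∀ n → n < 3 ^ n
n<3^n zero    = s≤s z≤n
n<3^n (suc n) = begin-strict
  suc n                 ≤⟨ n<3^n n ⟩
  3 ^ n                 <⟨ m<m+n (3 ^ n) (≤-trans (m^n>0 3 n) (m≤m+n (3 ^ n) _)) ⟩
  3 ^ n + (3 ^ n + (3 ^ n + 0)) ∎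
  where open ≤-Reasoning

middle-to-last-window : ∀ J d m e → d < 3 ^ J → e < 3 ^ J → d + m ≡ 3 ^ J + e →
  c (3 ^ J + d) ≡ 0 × c (3 ^ J + d + m) ≡ c e × sum (factorAt (3 ^ J + d) (suc m)) ≡ N (suc e)
middle-to-last-window J d m e d<P e<P d+m≡ = c-middle-third J d d<P , last-letter-is , count
  where
  P = 3 ^ J
  end : P + d + m ≡ P + P + e
  end = trans (+-assoc P d m) (trans (cong (P +_) d+m≡) (sym (+-assoc P P e)))
  last-letter-is : c (P + d + m) ≡ c e
  last-letter-is = trans (cong c end) (c-last-third J e e<P)
  count : sum (factorAt (P + d) (suc m)) ≡ N (suc e)
  count = +-cancelˡ-≡ (N (P + d)) _ _ (begin
    N (P + d) + sum (factorAt (P + d) (suc m)) ≡⟨ window-sum (P + d) (suc m) ⟩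
    N (P + d + suc m)
      ≡⟨ cong N (trans (+-suc (P + d) m) (trans (cong suc end) (sym (+-suc (P + P) e)))) ⟩
    N (P + P + suc e)                          ≡⟨ N-last-third J (suc e) e<P ⟩
    N P + N (suc e)                            ≡⟨ cong (_+ N (suc e)) (sym (N-middle-third J d (<⇒≤ d<P))) ⟩
    N (P + d) + N (suc e)                      ∎)
    where open ≡-Reasoning

first-to-middle-window : ∀ J d e m u → d + e ≡ 3 ^ J → d + m ≡ 3 ^ J + u → u < 3 ^ J →
  c (d + m) ≡ 0 × sum (factorAt d (suc m)) ≡ N e
first-to-middle-window J d e m u d+e≡P d+m≡ u<P = trans (cong c d+m≡) (c-middle-third J u u<P) , count
  where
  P = 3 ^ J
  count : sum (factorAt d (suc m)) ≡ N e
  count = +-cancelˡ-≡ (N d) _ _ (begin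
    N d + sum (factorAt d (suc m)) ≡⟨ window-sum d (suc m) ⟩
    N (d + suc m)                  ≡⟨ cong N (trans (+-suc d m) (trans (cong suc d+m≡) (sym (+-suc P u)))) ⟩
    N (P + suc u)                  ≡⟨ N-middle-third J (suc u) u<P ⟩
    N P                            ≡⟨ sym (N-reflect J d e d+e≡P) ⟩
    N d + N e                      ∎)
    where open ≡-Reasoning

middle-offset : ∀ {e m P} → e < m → m ≤ P → ∃ λ d → d < P × d + m ≡ P + e
middle-offset {e} {m} {P} e<m m≤P with m≤n⇒∃[o]m+o≡n m≤P
... | o , m+o≡P = o + e , subst (o + e <_) (trans (+-comm o m) m+o≡P) (+-monoʳ-< o e<m) ,
                  trans (regroup o e m) (cong (_+ e) m+o≡P)
  where
  regroup : ∀ o e m → o + e + m ≡ m + o + e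
  regroup = solve-∀

reflected-offset : ∀ {e m P} → e ≤ m → m < P → ∃₂ λ d u → d + e ≡ P × d + m ≡ P + u × u < P
reflected-offset {e} {m} {P} e≤m m<P with m≤n⇒∃[o]m+o≡n (≤-trans e≤m (<⇒≤ m<P)) | m≤n⇒∃[o]m+o≡n e≤m
... | d , e+d≡P | u , e+u≡m = d , u , d+e≡P , end , u<P
  where
  d+e≡P : d + e ≡ P
  d+e≡P = trans (+-comm d e) e+d≡P
  end : d + m ≡ P + u
  end = begin
    d + m       ≡⟨ cong (d +_) (sym e+u≡m) ⟩
    d + (e + u) ≡⟨ sym (+-assoc d e u) ⟩
    d + e + u   ≡⟨ cong (_+ u) d+e≡P ⟩
    P + u       ∎
    where open ≡-Reasoning
  u<P : u < P
  u<P = ≤-<-trans (m≤n+m u e) (subst (_< P) (sym e+u≡m) m<P)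

-- N grows by steps of at most 1, so every value below N m is N p at a 1-position p < m.
one-with-count : ∀ m j → j < N m → ∃ λ p → p < m × N p ≡ j × c p ≡ 1
one-with-count (suc m) j j<N with j <? N m
... | yes j<Nm = let p , p<m , Np≡j , cp≡1 = one-with-count m j j<Nm
                 in p , m<n⇒m<1+n p<m , Np≡j , cp≡1
... | no j≮Nm with c-binary m
...   | inj₁ cm≡0 = ⊥-elim (j≮Nm (subst (j <_) (trans (cong (N m +_) cm≡0) (+-identityʳ (N m))) j<N))
...   | inj₂ cm≡1 =
  m , ≤-refl , ≤-antisym (≮⇒≥ j≮Nm) (≤-pred (subst (j <_) (N-after-one m cm≡1) j<N)) , cm≡1

ones-at-distance : ∀ m → ∃ λ a → c a ≡ 1 × c (a + m * 2) ≡ 1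
ones-at-distance = <-rec OnesAt step
  where
  OnesAt : ℕ → Set
  OnesAt m = ∃ λ a → c a ≡ 1 × c (a + m * 2) ≡ 1
  step : ∀ m → (∀ {m′} → m′ < m → OnesAt m′) → OnesAt m
  step m ih with ternary m
  ... | digit0 zero = 0 , refl , refl
  ... | digit0 (suc q) =
    let a , ca≡1 , ca′≡1 = ih {suc q} (s≤s (s≤s (≤-trans (m≤m*n q 3) (n≤1+n _)))) in
    a * 3 , trans (c-digit0 a) ca≡1 , trans (cong c (distance a q)) (trans (c-digit0 (a + suc q * 2)) ca′≡1)
    where
    distance : ∀ a q → a * 3 + suc q * 3 * 2 ≡ (a + suc q * 2) * 3
    distance = solve-∀
  ... | digit1 q =
    let a , ca≡1 , ca′≡1 = ih {q} (s≤s (m≤m*n q 3)) in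
    a * 3 , trans (c-digit0 a) ca≡1 , trans (cong c (distance a q)) (trans (c-digit2 (a + q * 2)) ca′≡1)
    where
    distance : ∀ a q → a * 3 + (1 + q * 3) * 2 ≡ 2 + (a + q * 2) * 3
    distance = solve-∀
  ... | digit2 q =
    let a , ca≡1 , ca′≡1 = ih {suc q} (s≤s (s≤s (m≤m*n q 3))) in
    2 + a * 3 , trans (c-digit2 a) ca≡1 , trans (cong c (distance a q)) (trans (c-digit0 (a + suc q * 2)) ca′≡1)
    where
    distance : ∀ a q → 2 + a * 3 + (2 + q * 3) * 2 ≡ (a + suc q * 2) * 3
    distance = solve-∀

record OnePosition (x : ℕ) : Set where
  field
    β          : ℕ
    quotient   : ℕ
    β≤1        : β ≤ 1
    digits     : x ≡ β * 2 + quotient * 3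
    c-quotient : c quotient ≡ 1
    N-at       : N x ≡ N quotient + N quotient + β

open OnePosition

one-position : ∀ x → c x ≡ 1 → OnePosition x
one-position x cx≡1 with ternary x
... | digit0 q = record
  { β = 0 ; quotient = q ; β≤1 = z≤n ; digits = refl
  ; c-quotient = trans (sym (c-digit0 q)) cx≡1 ; N-at = trans (N-digit0 q) (sym (+-identityʳ _)) }
... | digit1 q with trans (sym (c-digit1 q)) cx≡1
...   | ()
one-position x cx≡1 | digit2 q = record
  { β = 1 ; quotient = q ; β≤1 = ≤-refl ; digits = refl
  ; c-quotient = cq≡1
  ; N-at = trans (N-digit2 q) (trans (cong (λ z → N q + (N q + z)) cq≡1) (sym (+-assoc (N q) (N q) 1))) }
  where
  cq≡1 : c q ≡ 1
  cq≡1 = trans (sym (c-digit2 q)) cx≡1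

even-digit-unique : ∀ s s′ X Y → s ≤ 2 → s′ ≤ 2 → s * 2 + X * 3 ≡ s′ * 2 + Y * 3 → s ≡ s′ × X ≡ Y
even-digit-unique s s′ X Y s≤2 s′≤2 eq =
  s≡s′ , *-cancelʳ-≡ X Y 3 (+-cancelˡ-≡ (s * 2) _ _ (trans eq (cong (λ z → z * 2 + Y * 3) (sym s≡s′))))
  where
  residues : (s * 2) % 3 ≡ (s′ * 2) % 3
  residues = trans (sym ([m+kn]%n≡m%n (s * 2) X 3)) (trans (cong (_% 3) eq) ([m+kn]%n≡m%n (s′ * 2) Y 3))
  by-residue : ∀ s s′ → s ≤ 2 → s′ ≤ 2 → (s * 2) % 3 ≡ (s′ * 2) % 3 → s ≡ s′
  by-residue 0 0 _ _ _ = refl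
  by-residue 1 1 _ _ _ = refl
  by-residue 2 2 _ _ _ = refl
  by-residue 0 1 _ _ ()
  by-residue 0 2 _ _ ()
  by-residue 1 0 _ _ ()
  by-residue 1 2 _ _ ()
  by-residue 2 0 _ _ ()
  by-residue 2 1 _ _ ()
  by-residue (suc (suc (suc _))) _ (s≤s (s≤s ())) _ _
  by-residue _ (suc (suc (suc _))) _ (s≤s (s≤s ())) _
  s≡s′ = by-residue s s′ s≤2 s′≤2 residues

quotient<self : ∀ t Q s → t * 2 + Q * 3 ≡ suc s → Q < suc s
quotient<self t zero    s _  = s≤s z≤n
quotient<self t (suc Q) s eq =
  subst (suc Q <_) eq (≤-trans (s≤s (s≤s (≤-trans (m≤m*n Q 3) (n≤1+n _)))) (m≤n+m _ (t * 2)))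

one-positions-sum : ∀ {a b} (A : OnePosition a) (B : OnePosition b) →
                    a + b ≡ (β A + β B) * 2 + (quotient A + quotient B) * 3
one-positions-sum A B = trans (cong₂ _+_ (digits A) (digits B)) (regroup (β A) (quotient A) (β B) (quotient B))
  where
  regroup : ∀ β q β′ q′ → (β * 2 + q * 3) + (β′ * 2 + q′ * 3) ≡ (β + β′) * 2 + (q + q′) * 3
  regroup = solve-∀

translation-split : ∀ {a b a′ b′} (A : OnePosition a) (B : OnePosition b)
                    (A′ : OnePosition a′) (B′ : OnePosition b′) →
                    a + b′ ≡ a′ + b →
                    β A + β B′ ≡ β A′ + β B × quotient A + quotient B′ ≡ quotient A′ + quotient B
translation-split A B A′ B′ eq =
  even-digit-unique _ _ _ _ (+-mono-≤ (β≤1 A) (β≤1 B′)) (+-mono-≤ (β≤1 A′) (β≤1 B))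
                    (trans (sym (one-positions-sum A B′)) (trans eq (one-positions-sum A′ B)))

translation-lift : ∀ {a b a′ b′} (A : OnePosition a) (B : OnePosition b)
                   (A′ : OnePosition a′) (B′ : OnePosition b′) →
                   β A + β B′ ≡ β A′ + β B →
                   N (quotient A) + N (quotient B′) ≡ N (quotient A′) + N (quotient B) →
                   N a + N b′ ≡ N a′ + N b
translation-lift {a} {b} {a′} {b′} A B A′ B′ digits≡ quotients≡ = begin
  N a + N b′                                    ≡⟨ cong₂ _+_ (N-at A) (N-at B′) ⟩
  (N qa + N qa + β A) + (N qb′ + N qb′ + β B′)  ≡⟨ regroup (N qa) (N qb′) (β A) (β B′) ⟩
  (N qa + N qb′) + (N qa + N qb′) + (β A + β B′) ≡⟨ cong₂ (λ u v → u + u + v) quotients≡ digits≡ ⟩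
  (N qa′ + N qb) + (N qa′ + N qb) + (β A′ + β B) ≡⟨ sym (regroup (N qa′) (N qb) (β A′) (β B)) ⟩
  (N qa′ + N qa′ + β A′) + (N qb + N qb + β B)  ≡⟨ sym (cong₂ _+_ (N-at A′) (N-at B)) ⟩
  N a′ + N b                                    ∎
  where
  open ≡-Reasoning
  qa = quotient A
  qb = quotient B
  qa′ = quotient A′
  qb′ = quotient B′
  regroup : ∀ p q β β′ → (p + p + β) + (q + q + β′) ≡ (p + q) + (p + q) + (β + β′)
  regroup = solve-∀

-- The number of 1s in a window from a 1-position to a 1-position depends only
-- on the length of the window: if a + b′ ≡ a′ + b then N b′ - N a′ = N b - N a.
-- Induction on a + b′, passing to the quotients.
N-translation : ∀ a b a′ b′ → c a ≡ 1 → c b ≡ 1 → c a′ ≡ 1 → c b′ ≡ 1 →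
                a + b′ ≡ a′ + b → N a + N b′ ≡ N a′ + N b
N-translation a b a′ b′ = <-rec Translation step (a + b′) a b a′ b′ refl
  where
  Translation : ℕ → Set
  Translation s = ∀ a b a′ b′ → a + b′ ≡ s → c a ≡ 1 → c b ≡ 1 → c a′ ≡ 1 → c b′ ≡ 1 →
                  a + b′ ≡ a′ + b → N a + N b′ ≡ N a′ + N b
  step : ∀ s → (∀ {s′} → s′ < s → Translation s′) → Translation s
  step zero _ a b a′ b′ a+b′≡0 _ _ _ _ eq =
    trans (cong₂ _+_ (cong N (m+n≡0⇒m≡0 a a+b′≡0)) (cong N (m+n≡0⇒n≡0 a a+b′≡0)))
          (sym (cong₂ _+_ (cong N (m+n≡0⇒m≡0 a′ a′+b≡0)) (cong N (m+n≡0⇒n≡0 a′ a′+b≡0))))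
    where
    a′+b≡0 : a′ + b ≡ 0
    a′+b≡0 = trans (sym eq) a+b′≡0
  step (suc s) ih a b a′ b′ a+b′≡ ca cb ca′ cb′ eq =
    translation-lift A B A′ B′ (proj₁ split)
      (ih smaller (quotient A) (quotient B) (quotient A′) (quotient B′) refl
          (c-quotient A) (c-quotient B) (c-quotient A′) (c-quotient B′) (proj₂ split))
    where
    A = one-position a ca
    B = one-position b cb
    A′ = one-position a′ ca′
    B′ = one-position b′ cb′
    split = translation-split A B A′ B′ eq
    smaller : quotient A + quotient B′ < suc s
    smaller = quotient<self (β A + β B′) _ s (trans (sym (one-positions-sum A B′)) a+b′≡)

one-to-one-windows : ∀ a i m → c a ≡ 1 → c (a + m) ≡ 1 → c i ≡ 1 → c (i + m) ≡ 1 →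
                     sum (factorAt i (suc m)) ≡ sum (factorAt a (suc m))
one-to-one-windows a i m ca ca+m ci ci+m = +-cancelˡ-≡ (N a + N i) _ _ (begin
  N a + N i + sum (factorAt i (suc m))   ≡⟨ +-assoc (N a) (N i) _ ⟩
  N a + (N i + sum (factorAt i (suc m))) ≡⟨ cong (N a +_) (ending-with-one i ci+m) ⟩
  N a + suc (N (i + m))                  ≡⟨ +-suc (N a) _ ⟩
  suc (N a + N (i + m))
    ≡⟨ cong suc (N-translation a i (a + m) (i + m) ca ci ca+m ci+m (regroup a i m)) ⟩
  suc (N (a + m) + N i)                  ≡⟨ move-suc (N (a + m)) (N i) ⟩
  N i + suc (N (a + m))                  ≡⟨ cong (N i +_) (sym (ending-with-one a ca+m)) ⟩
  N i + (N a + sum (factorAt a (suc m))) ≡⟨ left-commute (N i) (N a) _ ⟩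
  N a + N i + sum (factorAt a (suc m))   ∎)
  where
  open ≡-Reasoning
  regroup : ∀ a i m → a + (i + m) ≡ (a + m) + i
  regroup = solve-∀
  move-suc : ∀ p q → suc (p + q) ≡ q + suc p
  move-suc = solve-∀
  left-commute : ∀ p q r → p + (q + r) ≡ q + p + r
  left-commute = solve-∀
  ending-with-one : ∀ x → c (x + m) ≡ 1 → N x + sum (factorAt x (suc m)) ≡ suc (N (x + m))
  ending-with-one x cx+m = trans (window-sum x (suc m)) (trans (cong N (+-suc x m)) (N-after-one (x + m) cx+m))

data NoOneOne : List ℕ → Set where
  nil    : NoOneOne []
  cons0  : ∀ {u} → NoOneOne u → NoOneOne (0 ∷ u)
  one    : NoOneOne (1 ∷ [])
  cons10 : ∀ {u} → NoOneOne (0 ∷ u) → NoOneOne (1 ∷ 0 ∷ u)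

is1 : Maybe ℕ → ℕ
is1 (just 1) = 1
is1 _        = 0

is0 : Maybe ℕ → ℕ
is0 (just 0) = 1
is0 _        = 0

-- In a word without 11, every 1 but a leading one is preceded by a 0 ...
occ01-formula : ∀ {w} → NoOneOne w → occ2 0 1 w + is1 (head w) ≡ sum w
occ01-formula nil                = refl
occ01-formula (cons0 nil)        = refl
occ01-formula (cons0 (cons0 g))  = occ01-formula (cons0 g)
occ01-formula (cons0 one)        = refl
occ01-formula (cons0 (cons10 g)) = trans (+-identityʳ _) (trans (+-comm 1 _) (occ01-formula (cons10 g)))
occ01-formula one                = refl
occ01-formula (cons10 {u} g)     =
  trans (+-comm (occ2 0 1 (0 ∷ u)) 1) (cong suc (trans (sym (+-identityʳ _)) (occ01-formula g)))

-- ... every 1 but a trailing one is followed by a 0 ...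
occ10-formula : ∀ {w} → NoOneOne w → occ2 1 0 w + is1 (last w) ≡ sum w
occ10-formula nil                = refl
occ10-formula (cons0 nil)        = refl
occ10-formula (cons0 (cons0 g))  = occ10-formula (cons0 g)
occ10-formula (cons0 one)        = refl
occ10-formula (cons0 (cons10 g)) = occ10-formula (cons10 g)
occ10-formula one                = refl
occ10-formula (cons10 g)         = cong suc (occ10-formula g)

-- ... 11 never occurs ...
occ11-formula : ∀ {w} → NoOneOne w → occ2 1 1 w ≡ 0
occ11-formula nil                = refl
occ11-formula (cons0 nil)        = refl
occ11-formula (cons0 (cons0 g))  = occ11-formula (cons0 g)
occ11-formula (cons0 one)        = refl
occ11-formula (cons0 (cons10 g)) = occ11-formula (cons10 g)
occ11-formula one                = refl
occ11-formula (cons10 g)         = occ11-formula g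

-- ... and every position but the last starts one of 00, 01, 10.
occ00-formula : ∀ {w} → NoOneOne w → occ2 0 0 w + (occ2 0 1 w + (is0 (last w) + sum w)) ≡ length w
occ00-formula nil                    = refl
occ00-formula (cons0 nil)            = refl
occ00-formula (cons0 (cons0 g))      = cong suc (occ00-formula (cons0 g))
occ00-formula (cons0 one)            = refl
occ00-formula (cons0 (cons10 {u} g)) =
  trans (rearrange (occ2 0 0 (1 ∷ 0 ∷ u)) (occ2 0 1 (1 ∷ 0 ∷ u)) (is0 (last (0 ∷ u))) (sum u))
        (cong suc (occ00-formula (cons10 g)))
  where
  rearrange : ∀ p q l s → p + (suc q + (l + suc s)) ≡ suc (p + (q + (l + suc s)))
  rearrange = solve-∀
occ00-formula one                    = refl
occ00-formula (cons10 {u} g)         =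
  trans (rearrange (occ2 0 0 (0 ∷ u)) (occ2 0 1 (0 ∷ u)) (is0 (last (0 ∷ u))) (sum u))
        (cong suc (occ00-formula g))
  where
  rearrange : ∀ p q l s → p + (q + (l + suc s)) ≡ suc (p + (q + (l + s)))
  rearrange = solve-∀

data Bit : ℕ → Set where
  bit0 : Bit 0
  bit1 : Bit 1

NoOneOne⇒binary : ∀ {w} → NoOneOne w → All Bit w
NoOneOne⇒binary nil        = []
NoOneOne⇒binary (cons0 g)  = bit0 ∷ NoOneOne⇒binary g
NoOneOne⇒binary one        = bit1 ∷ []
NoOneOne⇒binary (cons10 g) = bit1 ∷ NoOneOne⇒binary g

occ-vanishes : ∀ a b {w} → (∀ {x y} → Bit x → Bit y → isPair a b x y ≡ 0) → All Bit w → occ2 a b w ≡ 0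
occ-vanishes a b never []                = refl
occ-vanishes a b never (_ ∷ [])          = refl
occ-vanishes a b never (bx ∷ by ∷ bits)  = cong₂ _+_ (never bx by) (occ-vanishes a b never (by ∷ bits))

isPair-left-large : ∀ a b {x y} → Bit x → Bit y → isPair (2 + a) b x y ≡ 0
isPair-left-large a b bit0 _ = refl
isPair-left-large a b bit1 _ = refl

isPair-right-large : ∀ a b {x y} → Bit x → Bit y → isPair a (2 + b) x y ≡ 0
isPair-right-large a b {x} _ bit0 with x ≟ a
... | yes _ = refl
... | no _  = refl
isPair-right-large a b {x} _ bit1 with x ≟ a
... | yes _ = refl
... | no _  = refl

same-occurrences : ∀ {u v} → NoOneOne u → NoOneOne v → length u ≡ length v →
                   head u ≡ head v → last u ≡ last v → sum u ≡ sum v →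
                   ∀ a b → occ2 a b u ≡ occ2 a b v
same-occurrences {u} {v} gu gv _ heads _ sums 0 1 =
  +-cancelʳ-≡ (is1 (head u)) _ _ (begin
    occ2 0 1 u + is1 (head u) ≡⟨ occ01-formula gu ⟩
    sum u                     ≡⟨ sums ⟩
    sum v                     ≡⟨ sym (occ01-formula gv) ⟩
    occ2 0 1 v + is1 (head v) ≡⟨ cong (λ h → occ2 0 1 v + is1 h) (sym heads) ⟩
    occ2 0 1 v + is1 (head u) ∎)
  where open ≡-Reasoning
same-occurrences {u} {v} gu gv _ _ lasts sums 1 0 =
  +-cancelʳ-≡ (is1 (last u)) _ _ (begin
    occ2 1 0 u + is1 (last u) ≡⟨ occ10-formula gu ⟩
    sum u                     ≡⟨ sums ⟩
    sum v                     ≡⟨ sym (occ10-formula gv) ⟩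
    occ2 1 0 v + is1 (last v) ≡⟨ cong (λ l → occ2 1 0 v + is1 l) (sym lasts) ⟩
    occ2 1 0 v + is1 (last u) ∎)
  where open ≡-Reasoning
same-occurrences gu gv _ _ _ _ 1 1 = trans (occ11-formula gu) (sym (occ11-formula gv))
same-occurrences {u} {v} gu gv lengths heads lasts sums 0 0 =
  +-cancelʳ-≡ _ _ _ (begin
    occ2 0 0 u + (occ2 0 1 u + (is0 (last u) + sum u)) ≡⟨ occ00-formula gu ⟩
    length u                                           ≡⟨ lengths ⟩
    length v                                           ≡⟨ sym (occ00-formula gv) ⟩
    occ2 0 0 v + (occ2 0 1 v + (is0 (last v) + sum v))
      ≡⟨ cong (occ2 0 0 v +_) (cong₂ _+_ (sym (same-occurrences gu gv lengths heads lasts sums 0 1))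
                                         (cong₂ _+_ (cong is0 (sym lasts)) (sym sums))) ⟩
    occ2 0 0 v + (occ2 0 1 u + (is0 (last u) + sum u)) ∎)
  where open ≡-Reasoning
same-occurrences gu gv _ _ _ _ (suc (suc a)) b =
  trans (occ-vanishes (2 + a) b (isPair-left-large a b) (NoOneOne⇒binary gu))
        (sym (occ-vanishes (2 + a) b (isPair-left-large a b) (NoOneOne⇒binary gv)))
same-occurrences gu gv _ _ _ _ 0 (suc (suc b)) =
  trans (occ-vanishes 0 (2 + b) (isPair-right-large 0 b) (NoOneOne⇒binary gu))
        (sym (occ-vanishes 0 (2 + b) (isPair-right-large 0 b) (NoOneOne⇒binary gv)))
same-occurrences gu gv _ _ _ _ 1 (suc (suc b)) =
  trans (occ-vanishes 1 (2 + b) (isPair-right-large 1 b) (NoOneOne⇒binary gu))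
        (sym (occ-vanishes 1 (2 + b) (isPair-right-large 1 b) (NoOneOne⇒binary gv)))

-- Conversely ∼₂ determines the number of 1s, through the count of 01.
∼₂⇒same-sum : ∀ {u v} → NoOneOne u → NoOneOne v → u ∼₂ v → sum u ≡ sum v
∼₂⇒same-sum gu gv (heads , _ , occs) =
  trans (sym (occ01-formula gu)) (trans (cong₂ (λ k h → k + is1 h) (occs 0 1) heads) (occ01-formula gv))

factor-length : ∀ i n → length (factorAt i n) ≡ n
factor-length i zero    = refl
factor-length i (suc n) = cong suc (factor-length (suc i) n)

factor-NoOneOne : ∀ i n → NoOneOne (factorAt i n)
factor-NoOneOne i zero = nil
factor-NoOneOne i (suc n) with c-binary i
... | inj₁ ci≡0 rewrite ci≡0 = cons0 (factor-NoOneOne (suc i) n)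
factor-NoOneOne i (suc zero)    | inj₂ ci≡1 rewrite ci≡1 = one
factor-NoOneOne i (suc (suc n)) | inj₂ ci≡1 =
  subst₂ (λ x y → NoOneOne (x ∷ y ∷ factorAt (suc (suc i)) n)) (sym ci≡1) (sym next≡0)
         (cons10 (subst (λ z → NoOneOne (z ∷ factorAt (suc (suc i)) n)) next≡0 (factor-NoOneOne (suc i) (suc n))))
  where
  next≡0 : c (suc i) ≡ 0
  next≡0 = c-no-11 i ci≡1

same-sum⇒∼₂ : ∀ {n x y u v} → InW n x y u → InW n x y v → sum u ≡ sum v → u ∼₂ v
same-sum⇒∼₂ {n} ((i , refl) , hu , lu) ((j , refl) , hv , lv) sums =
  heads , lasts ,
  same-occurrences (factor-NoOneOne i n) (factor-NoOneOne j n)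
                   (trans (factor-length i n) (sym (factor-length j n))) heads lasts sums
  where
  heads = trans hu (sym hv)
  lasts = trans lu (sym lv)

∼₂⇒same-sum-in-W : ∀ {n x y u v} → InW n x y u → InW n x y v → u ∼₂ v → sum u ≡ sum v
∼₂⇒same-sum-in-W {n} ((i , refl) , _) ((j , refl) , _) = ∼₂⇒same-sum (factor-NoOneOne i n) (factor-NoOneOne j n)

module CountBySums (n x y lo k : ℕ)
  (attained : ∀ j → j < k → ∃ λ i → InW n x y (factorAt i n) × sum (factorAt i n) ≡ lo + j)
  (bounded  : ∀ w → InW n x y w → lo ≤ sum w × sum w < lo + k) where

  chosen : ∀ j → j < k → List ℕ
  chosen j j<k = factorAt (proj₁ (attained j j<k)) n

  chosen∈W : ∀ j j<k → InW n x y (chosen j j<k)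
  chosen∈W j j<k = proj₁ (proj₂ (attained j j<k))

  chosen-sum : ∀ j j<k → sum (chosen j j<k) ≡ lo + j
  chosen-sum j j<k = proj₂ (proj₂ (attained j j<k))

  representatives : ∀ m → m ≤ k → List (List ℕ)
  representatives zero    _   = []
  representatives (suc m) m<k = chosen m m<k ∷ representatives m (<⇒≤ m<k)

  representatives-length : ∀ m m≤k → length (representatives m m≤k) ≡ m
  representatives-length zero    _   = refl
  representatives-length (suc m) m<k = cong suc (representatives-length m (<⇒≤ m<k))

  representatives-below : ∀ m m≤k → All (λ v → InW n x y v × sum v < lo + m) (representatives m m≤k)
  representatives-below zero    _   = []
  representatives-below (suc m) m<k =
    (chosen∈W m m<k , subst (_< lo + suc m) (sym (chosen-sum m m<k)) (+-monoʳ-< lo ≤-refl)) ∷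
    All.map (λ (v∈W , v<) → v∈W , ≤-trans v< (+-monoʳ-≤ lo (n≤1+n m))) (representatives-below m (<⇒≤ m<k))

  representatives-distinct : ∀ m m≤k → AllPairs (λ u v → ¬ (u ∼₂ v)) (representatives m m≤k)
  representatives-distinct zero    _   = []
  representatives-distinct (suc m) m<k =
    All.map distinct (representatives-below m (<⇒≤ m<k)) ∷ representatives-distinct m (<⇒≤ m<k)
    where
    distinct : ∀ {v} → InW n x y v × sum v < lo + m → ¬ (chosen m m<k ∼₂ v)
    distinct (v∈W , v<) u∼v =
      <-irrefl (trans (sym (∼₂⇒same-sum-in-W (chosen∈W m m<k) v∈W u∼v)) (chosen-sum m m<k)) v<

  representatives-cover : ∀ w → InW n x y w → ∀ j → sum w ≡ lo + j →
                          ∀ m m≤k → j < m → Any (w ∼₂_) (representatives m m≤k)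
  representatives-cover w w∈W j sum≡ (suc m) m<k j<1+m with j ≟ m
  ... | yes refl = here (same-sum⇒∼₂ w∈W (chosen∈W m m<k) (trans sum≡ (sym (chosen-sum m m<k))))
  ... | no j≢m   = there (representatives-cover w w∈W j sum≡ m (<⇒≤ m<k) (≤∧≢⇒< (≤-pred j<1+m) j≢m))

  p₂-count : P2 n x y k
  p₂-count = representatives k ≤-refl , representatives-length k ≤-refl ,
             All.map proj₁ (representatives-below k ≤-refl) , representatives-distinct k ≤-refl ,
             cover
    where
    cover : ∀ w → InW n x y w → Any (w ∼₂_) (representatives k ≤-refl)
    cover w w∈W with bounded w w∈W
    ... | lo≤ , <lo+k with m≤n⇒∃[o]m+o≡n lo≤
    ... | j , lo+j≡ = representatives-cover w w∈W j (sym lo+j≡) k ≤-refl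
                        (+-cancelˡ-< lo j k (subst (_< lo + k) (sym lo+j≡) <lo+k))

factor-in-W : ∀ i m {x y} → c i ≡ x → c (i + m) ≡ y → InW (suc m) x y (factorAt i (suc m))
factor-in-W i m cx cy = (i , refl) , cong just cx , trans (window-last i m) (cong just cy)

first-letter : ∀ i {m x y} → InW (suc m) x y (factorAt i (suc m)) → c i ≡ x
first-letter i (_ , h , _) = just-injective h

last-letter : ∀ i {m x y} → InW (suc m) x y (factorAt i (suc m)) → c (i + m) ≡ y
last-letter i {m} (_ , _ , l) = just-injective (trans (sym (window-last i m)) l)

p₂-empty : ∀ n x y → (∀ w → ¬ InW n x y w) → P2 n x y 0
p₂-empty n x y empty = [] , refl , [] , [] , λ w w∈W → ⊥-elim (empty w w∈W)

p₂-1-diagonal : ∀ x i → c i ≡ x → P2 1 x x 1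
p₂-1-diagonal x i ci≡x = CountBySums.p₂-count 1 x x x 1 attained bounded
  where
  attained : ∀ j → j < 1 → ∃ λ i′ → InW 1 x x (factorAt i′ 1) × sum (factorAt i′ 1) ≡ x + j
  attained zero    _ = i , factor-in-W i 0 ci≡x (trans (cong c (+-identityʳ i)) ci≡x) ,
                       trans (+-identityʳ (c i)) (trans ci≡x (sym (+-identityʳ x)))
  attained (suc j) (s≤s ())
  bounded : ∀ w → InW 1 x x w → x ≤ sum w × sum w < x + 1
  bounded _ w∈W@((i′ , refl) , _) = ≤-reflexive (sym sum≡x) , subst (_< x + 1) (sym sum≡x) (m<m+n x (s≤s z≤n))
    where
    sum≡x : sum (factorAt i′ 1) ≡ x
    sum≡x = trans (+-identityʳ (c i′)) (first-letter i′ w∈W)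

p₂-1-off-diagonal : ∀ x y → x ≢ y → P2 1 x y 0
p₂-1-off-diagonal x y x≢y = p₂-empty 1 x y λ { _ ((i , refl) , h , l) → x≢y (just-injective (trans (sym h) l)) }

-- Words of length n = k + 2 ≥ 2.  Witnesses are placed inside the block
-- [0, 3P) with P = 3 ^ n, whose thirds have length P > n.
module LongWords (k : ℕ) where
  n : ℕ
  n = suc (suc k)

  P : ℕ
  P = 3 ^ n

  k+1<P : suc k < P
  k+1<P = ≤-trans (n≤1+n n) (n<3^n n)

  -- 0 … 0: the interior has at most M_c(k) ones, and every value 0, …, N k occurs.
  p₂-00 : P2 n 0 0 (suc (N k))
  p₂-00 = CountBySums.p₂-count n 0 0 0 (suc (N k)) attained bounded
    where
    bounded : ∀ w → InW n 0 0 w → 0 ≤ sum w × sum w < 0 + suc (N k)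
    bounded _ w∈W@((i , refl) , _) = z≤n , s≤s (subst (_≤ N k) (sym interior) (window-bound (suc i) k))
      where
      interior : sum (factorAt i n) ≡ sum (factorAt (suc i) k)
      interior = begin
        c i + sum (factorAt (suc i) (suc k))
          ≡⟨ cong₂ _+_ (first-letter i w∈W) (window-sum-snoc (suc i) k) ⟩
        sum (factorAt (suc i) k) + c (suc i + k)
          ≡⟨ cong (λ z → sum (factorAt (suc i) k) + c z) (sym (+-suc i k)) ⟩
        sum (factorAt (suc i) k) + c (i + suc k) ≡⟨ cong (sum (factorAt (suc i) k) +_) (last-letter i w∈W) ⟩
        sum (factorAt (suc i) k) + 0             ≡⟨ +-identityʳ _ ⟩
        sum (factorAt (suc i) k)                 ∎
        where open ≡-Reasoning
    attained : ∀ j → j < suc (N k) → ∃ λ i → InW n 0 0 (factorAt i n) × sum (factorAt i n) ≡ 0 + j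
    -- no 1 at all: the start of the middle third
    attained zero _ =
      P , factor-in-W P (suc k) (trans (cong c (sym (+-identityʳ P))) (c-middle-third n 0 (m^n>0 3 n)))
                               (c-middle-third n (suc k) k+1<P) ,
      +-cancelˡ-≡ (N P) _ 0 (trans (window-sum P n)
                            (trans (N-middle-third n n (<⇒≤ (n<3^n n))) (sym (+-identityʳ (N P)))))
    -- j + 1 ones: end just after a 1 of the last third whose prefix holds j ones
    attained (suc j) (s≤s j<Nk) =
      let p , p<k , Np≡j , cp≡1 = one-with-count k j j<Nk
          d , d<P , d+m≡ = middle-offset {suc p} {suc k} {P} (s≤s p<k) (<⇒≤ k+1<P)
          first , last , count = middle-to-last-window n d (suc k) (suc p) d<P (≤-trans (s≤s p<k) (<⇒≤ k+1<P)) d+m≡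
      in P + d , factor-in-W (P + d) (suc k) first (trans last (c-no-11 p cp≡1)) ,
         trans count (trans (N-after-one-zero p cp≡1) (cong suc Np≡j))

  -- 1 … 0: drop the final 0; the values 1, …, N (k + 1) occur by reflection.
  p₂-10 : P2 n 1 0 (N (suc k))
  p₂-10 = CountBySums.p₂-count n 1 0 1 (N (suc k)) attained bounded
    where
    bounded : ∀ w → InW n 1 0 w → 1 ≤ sum w × sum w < 1 + N (suc k)
    bounded _ w∈W@((i , refl) , _) =
      subst (λ z → 1 ≤ z + sum (factorAt (suc i) (suc k))) (sym (first-letter i w∈W)) (s≤s z≤n) ,
      s≤s (subst (_≤ N (suc k)) (sym prefix) (window-bound i (suc k)))
      where
      prefix : sum (factorAt i n) ≡ sum (factorAt i (suc k))
      prefix = trans (window-sum-snoc i (suc k))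
                     (trans (cong (sum (factorAt i (suc k)) +_) (last-letter i w∈W)) (+-identityʳ _))
    attained : ∀ j → j < N (suc k) → ∃ λ i → InW n 1 0 (factorAt i n) × sum (factorAt i n) ≡ 1 + j
    attained j j<N =
      let p , p<k+1 , Np≡j , cp≡1 = one-with-count (suc k) j j<N
          d , u , d+p+1≡P , d+m≡ , u<P = reflected-offset {suc p} {suc k} {P} p<k+1 k+1<P
          last , count = first-to-middle-window n d (suc p) (suc k) u d+p+1≡P d+m≡ u<P
      in d , factor-in-W d (suc k) (trans (c-reflect n d p d+p+1≡P) cp≡1) last ,
         trans count (trans (N-after-one p cp≡1) (cong suc Np≡j))

  -- 0 … 1: drop the initial 0; the values 1, …, N (k + 1) occur in the last third.
  p₂-01 : P2 n 0 1 (N (suc k))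
  p₂-01 = CountBySums.p₂-count n 0 1 1 (N (suc k)) attained bounded
    where
    bounded : ∀ w → InW n 0 1 w → 1 ≤ sum w × sum w < 1 + N (suc k)
    bounded _ w∈W@((i , refl) , _) =
      subst (1 ≤_) (sym suffix-one) (m≤n+m 1 _) ,
      s≤s (subst (_≤ N (suc k)) (sym suffix) (window-bound (suc i) (suc k)))
      where
      suffix : sum (factorAt i n) ≡ sum (factorAt (suc i) (suc k))
      suffix = cong (_+ sum (factorAt (suc i) (suc k))) (first-letter i w∈W)
      suffix-one : sum (factorAt i n) ≡ sum (factorAt i (suc k)) + 1
      suffix-one = trans (window-sum-snoc i (suc k)) (cong (sum (factorAt i (suc k)) +_) (last-letter i w∈W))
    attained : ∀ j → j < N (suc k) → ∃ λ i → InW n 0 1 (factorAt i n) × sum (factorAt i n) ≡ 1 + j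
    attained j j<N =
      let p , p<k+1 , Np≡j , cp≡1 = one-with-count (suc k) j j<N
          d , d<P , d+m≡ = middle-offset {p} {suc k} {P} p<k+1 (<⇒≤ k+1<P)
          first , last , count = middle-to-last-window n d (suc k) p d<P (≤-trans p<k+1 (<⇒≤ k+1<P)) d+m≡
      in P + d , factor-in-W (P + d) (suc k) first (trans last cp≡1) ,
         trans count (trans (N-after-one p cp≡1) (cong suc Np≡j))

  -- 1 … 1 with n even: 1s sit at even positions, which are an odd distance n - 1 apart.
  p₂-11-even : n % 2 ≡ 0 → P2 n 1 1 0
  p₂-11-even n-even = p₂-empty n 1 1 λ { _ w∈W@((i , refl) , _) →
    2∤1 (∣m+n∣m⇒∣n (subst (2 ∣_) (+-comm 1 (suc k)) (m%n≡0⇒n∣m n 2 n-even))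
                    (∣m+n∣m⇒∣n (c-one⇒even (i + suc k) (last-letter i w∈W))
                               (c-one⇒even i (first-letter i w∈W)))) }

  -- 1 … 1 with n odd: two 1s at distance n - 1 exist, and all such factors have equally many 1s.
  p₂-11-odd : n % 2 ≡ 1 → P2 n 1 1 1
  p₂-11-odd n-odd = CountBySums.p₂-count n 1 1 (sum (factorAt a n)) 1 attained bounded
    where
    half-distance : suc k ≡ (n / 2) * 2
    half-distance = cong pred (trans (m≡m%n+[m/n]*n n 2) (cong (_+ (n / 2) * 2) n-odd))
    a : ℕ
    a = proj₁ (ones-at-distance (n / 2))
    ca≡1 : c a ≡ 1
    ca≡1 = proj₁ (proj₂ (ones-at-distance (n / 2)))
    ca+k+1≡1 : c (a + suc k) ≡ 1
    ca+k+1≡1 = trans (cong (λ z → c (a + z)) half-distance) (proj₂ (proj₂ (ones-at-distance (n / 2))))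
    attained : ∀ j → j < 1 → ∃ λ i → InW n 1 1 (factorAt i n) × sum (factorAt i n) ≡ sum (factorAt a n) + j
    attained zero    _ = a , factor-in-W a (suc k) ca≡1 ca+k+1≡1 , sym (+-identityʳ _)
    attained (suc j) (s≤s ())
    bounded : ∀ w → InW n 1 1 w → sum (factorAt a n) ≤ sum w × sum w < sum (factorAt a n) + 1
    bounded _ w∈W@((i , refl) , _) =
      ≤-reflexive (sym same) , subst (_< sum (factorAt a n) + 1) (sym same) (m<m+n _ (s≤s z≤n))
      where
      same : sum (factorAt i n) ≡ sum (factorAt a n)
      same = one-to-one-windows a i (suc k) ca≡1 ca+k+1≡1 (first-letter i w∈W) (last-letter i w∈W)

proposition4p2 :
    (P2 1 0 0 1 × P2 1 1 1 1 × P2 1 0 1 0 × P2 1 1 0 0)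
    × (∀ n → 2 ≤ n →
        ∃₂ λ m₁ m₂ → IsMc (n ∸ 2) m₁ × IsMc (n ∸ 1) m₂
          × P2 n 0 0 (suc m₁) × P2 n 1 0 m₂ × P2 n 0 1 m₂
          × (n % 2 ≡ 0 → P2 n 1 1 0) × (n % 2 ≡ 1 → P2 n 1 1 1))
proposition4p2 =
  (p₂-1-diagonal 0 1 refl , p₂-1-diagonal 1 0 refl , p₂-1-off-diagonal 0 1 (λ ()) , p₂-1-off-diagonal 1 0 (λ ())) ,
  λ { (suc (suc k)) (s≤s (s≤s _)) → let open LongWords k in
      N k , N (suc k) , IsMc-N k , IsMc-N (suc k) , p₂-00 , p₂-10 , p₂-01 , p₂-11-even , p₂-11-odd }
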